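{- Let $G$ be a graph with maximum degree at most $3$ whose number of vertices $n$ is a power of $2$, and let $k$ be an integer with $1<k<n-1$. Let $(G',k')$ be constructed from $(G,k)$ as described in the context. If $G$ has a vertex cover of size $k$, then $G'$ has a treedepth decomposition of weighted depth $k'$.
   Context: A vertex cover of $G$ is a set $C\subseteq V(G)$ containing at least one endpoint of every edge. A treedepth decomposition of a vertex-weighted graph $H$ is a rooted forest $F$ with $V(F)=V(H)$ such that for every edge $uv\in E(H)$, $u$ is an ancestor of $v$ or $v$ is an ancestor of $u$ in $F$; its weighted depth is the maximum over root-to-leaf paths of the sum of the weights of the vertices on the path. Construction of the weighted graph $G'$ and integer $k'$: (1) for every $v\in V(G)$, $G'$ has two vertices $v_1,v_2$ of weight $2$; (2) for every edge $uv\in E(G)$, $G'$ has the edges $u_1v_1$, $u_2v_2$, $u_1v_2$, $u_2v_1$; (3) for every $v\in V(G)$, $G'$ has three vertices $v_{g_1},v_{g_2},v_{g_3}$ of weight $1$, each adjacent to both $v_1$ and $v_2$; (4) $G'$ contains three complete binary trees $T_1,T_2,T_3$, each with exactly $n$ leaves (depth $\log n$), and for each $i\in\{1,2,3\}$ and $v\in V(G)$ there is a distinct leaf of $T_i$ named $v_{t_i}$; (5) for every $v\in V(G)$, $v_1$ and $v_{g_1}$ are adjacent to $v_{t_1}$, $v_2$ and $v_{g_2}$ are adjacent to $v_{t_2}$, and $v_{g_3}$ is adjacent to $v_{t_3}$; there are no other edges; (6) the root of each $T_i$ has weight $\beta=3n+k+3$, and if $y$ is a child of $x$ in some $T_i$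 then $w(y)=w(x)+3$; (7) $\alpha=\sum_{i=0}^{\log n}(\beta+3i)$ (the weight of a leaf-to-root path in $T_i$), and $k'=3n+k+\alpha+2$. Logarithms are base $2$. -}

module Defs where

open import Data.Nat using (ℕ; zero; suc; _+_; _*_; _∸_; _^_; _≤_; _<_)
open import Data.Fin using (Fin; toℕ) renaming (zero to fz; suc to fs)
open import Data.Fin.Subset using (Subset; _∈_; ∣_∣)
open import Data.Vec using (tabulate)
open import Data.Bool using (Bool; true; false)
open import Data.List using (List; []; _∷_; map; upTo)
open import Data.Nat.ListAction using (sum)
open import Data.Maybe using (Maybe; just; nothing)
open import Data.Product using (Σ; ∃; _×_)
open import Data.Sum using (_⊎_)
open import Relation.Binary.PropositionalEquality using (_≡_)

record SimpleGraph (n : ℕ) : Set where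
  field
    adj   : Fin n → Fin n → Bool
    sym   : ∀ u v → adj u v ≡ adj v u
    irrefl : ∀ v → adj v v ≡ false

open SimpleGraph public

nbhd : ∀ {n} → SimpleGraph n → Fin n → Subset n
nbhd G v = tabulate (adj G v)

degree : ∀ {n} → SimpleGraph n → Fin n → ℕ
degree G v = ∣ nbhd G v ∣

MaxDegreeAtMost : ∀ {n} → SimpleGraph n → ℕ → Set
MaxDegreeAtMost G d = ∀ v → degree G v ≤ d

IsVertexCover : ∀ {n} → SimpleGraph n → Subset n → Set
IsVertexCover G C = ∀ u v → adj G u v ≡ true → u ∈ C ⊎ v ∈ C

HasVertexCoverOfSize : ∀ {n} → SimpleGraph n → ℕ → Set
HasVertexCoverOfSize G k = Σ (Subset _) λ C → IsVertexCover G C × ∣ C ∣ ≡ k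

-- A rooted forest on V is given by a parent function; `Chain par x l`
-- says that l = x ∷ par x ∷ par (par x) ∷ … ∷ root is the path from x
-- up to its root.

data Chain {V : Set} (par : V → Maybe V) : V → List V → Set where
  root : ∀ {x} → par x ≡ nothing → Chain par x (x ∷ [])
  step : ∀ {x y l} → par x ≡ just y → Chain par y l → Chain par x (x ∷ l)

data Ancestor {V : Set} (par : V → Maybe V) (u : V) : V → Set where
  parent : ∀ {v} → par v ≡ just u → Ancestor par u v
  up     : ∀ {v y} → par v ≡ just y → Ancestor par u y → Ancestor par u v

record TreedepthDecomposition (V : Set) (E : V → V → Set) : Set where
  field
    par     : V → Maybe V
    -- every vertex lies in a finite rooted tree (no cycles)
    rooted  : ∀ x → ∃ λ l → Chain par x l
    edgesOK : ∀ u v → E u v → Ancestor par u v ⊎ Ancestor par v u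

open TreedepthDecomposition public

-- weighted depth: the maximum of the weights of root-to-vertex paths
-- (equivalently root-to-leaf paths, since weights are ≥ 0) is ≤ K
WeightedDepthAtMost : ∀ {V E} → (V → ℕ) → TreedepthDecomposition V E → ℕ → Set
WeightedDepthAtMost w F K = ∀ x l → Chain (par F) x l → sum (map w l) ≤ K

HasTDOfWeightedDepth : (V : Set) (E : V → V → Set) → (V → ℕ) → ℕ → Set
HasTDOfWeightedDepth V E w K =
  Σ (TreedepthDecomposition V E) λ F → WeightedDepthAtMost w F K

-- The construction (G', k') for n = 2 ^ m (so log n = m).
-- Tree nodes: t i d p is the node of T_(i+1) at depth d (root depth 0)
-- with position p among the 2^d nodes of that depth; the children of
-- (d , p) are (d+1 , 2p) and (d+1 , 2p+1).  The leaf v_{t_i} is the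
-- node at depth m with position v.

data V' (m : ℕ) : Set where
  v₁ v₂ g₁ g₂ g₃ : Fin (2 ^ m) → V' m
  t : Fin 3 → (d : Fin (suc m)) → Fin (2 ^ toℕ d) → V' m

IsLeaf : ∀ {m} → Fin (2 ^ m) → (d : Fin (suc m)) → Fin (2 ^ toℕ d) → Set
IsLeaf {m} v d p = toℕ d ≡ m × toℕ p ≡ toℕ v

t1 t2 t3 : Fin 3
t1 = fz
t2 = fs fz
t3 = fs (fs fz)

data E₀ {m : ℕ} (G : SimpleGraph (2 ^ m)) : V' m → V' m → Set where
  e11 : ∀ {u v} → adj G u v ≡ true → E₀ G (v₁ u) (v₁ v)
  e22 : ∀ {u v} → adj G u v ≡ true → E₀ G (v₂ u) (v₂ v)
  e12 : ∀ {u v} → adj G u v ≡ true → E₀ G (v₁ u) (v₂ v)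
  e21 : ∀ {u v} → adj G u v ≡ true → E₀ G (v₂ u) (v₁ v)
  g1-1 : ∀ {v} → E₀ G (g₁ v) (v₁ v)
  g1-2 : ∀ {v} → E₀ G (g₁ v) (v₂ v)
  g2-1 : ∀ {v} → E₀ G (g₂ v) (v₁ v)
  g2-2 : ∀ {v} → E₀ G (g₂ v) (v₂ v)
  g3-1 : ∀ {v} → E₀ G (g₃ v) (v₁ v)
  g3-2 : ∀ {v} → E₀ G (g₃ v) (v₂ v)
  tree : ∀ {i d p d' p'} → toℕ d' ≡ suc (toℕ d) →
         (toℕ p' ≡ 2 * toℕ p ⊎ toℕ p' ≡ suc (2 * toℕ p)) →
         E₀ G (t i d p) (t i d' p')
  l-v1 : ∀ {v d p} → IsLeaf v d p → E₀ G (v₁ v) (t t1 d p)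
  l-g1 : ∀ {v d p} → IsLeaf v d p → E₀ G (g₁ v) (t t1 d p)
  l-v2 : ∀ {v d p} → IsLeaf v d p → E₀ G (v₂ v) (t t2 d p)
  l-g2 : ∀ {v d p} → IsLeaf v d p → E₀ G (g₂ v) (t t2 d p)
  l-g3 : ∀ {v d p} → IsLeaf v d p → E₀ G (g₃ v) (t t3 d p)

E' : ∀ {m} → SimpleGraph (2 ^ m) → V' m → V' m → Set
E' G x y = E₀ G x y ⊎ E₀ G y x

β : ℕ → ℕ → ℕ
β m k = 3 * 2 ^ m + k + 3

w' : ∀ {m} → ℕ → V' m → ℕ
w' k (v₁ _) = 2
w' k (v₂ _) = 2
w' k (g₁ _) = 1
w' k (g₂ _) = 1
w' k (g₃ _) = 1
w' {m} k (t _ d _) = β m k + 3 * toℕ d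

α : ℕ → ℕ → ℕ
α m k = sum (map (λ i → β m k + 3 * i) (upTo (suc m)))

k' : ℕ → ℕ → ℕ
k' m k = 3 * 2 ^ m + k + α m k + 2

-- Take a vertex cover C with |C| = k and build the decomposition as one root path, the spine,
-- followed by the three trees.  The spine runs through the vertices v = 0, …, n-1 in order and
-- contributes a block for each: v₁ above v₂ (weight 4) if v ∈ C, and g₁ above g₂ above g₃
-- (weight 3) otherwise, so it weighs 3n + k.  The trees T₁, T₂, T₃ hang below its last vertex in
-- their own shape, and each remaining gadget vertex (v₁, v₂ for v ∉ C, the g's for v ∈ C) hangs
-- below its leaf of T₁, T₂ or T₃; having weight at most 2, it ends a root path of weight at most
-- 3n + k + α + 2.
--
-- The weight of the root path ending at x is a potential `height x` that strictly decreases
-- towards the root, which both bounds the depth and shows that the forest has no cycles.  Every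
-- edge of G' is a parent edge or has an endpoint on the spine (for the edges coming from G because
-- C is a cover), and a spine vertex is related to every other vertex: to the rest of the spine because
-- both are ancestors of its last vertex, and to everything else because that last vertex is.

module Submission where

open import Defs hiding (sym)
open import Data.Nat using (ℕ; zero; suc; _+_; _*_; _∸_; _^_; _≤_; _<_; z≤n; s≤s; s≤s⁻¹; ⌊_/2⌋; ⌈_/2⌉; pred; NonZero)
open import Data.Nat.Properties
open import Data.Nat.Induction using (<-wellFounded)
open import Data.Nat.Tactic.RingSolver using (solve-∀)
open import Data.Nat.ListAction using (sum)
open import Data.Nat.ListAction.Properties using (sum-++)
open import Data.Fin using (Fin; toℕ; fromℕ; fromℕ<; inject₁) renaming (zero to fz; suc to fs)
open import Data.Fin.Properties using (toℕ-injective; toℕ<n; toℕ-fromℕ<; toℕ-fromℕ; toℕ-inject₁; toℕ≤pred[n])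
open import Data.Fin.Induction using (<-weakInduction)
open import Data.Fin.Subset using (Subset; ∣_∣)
open import Data.Vec using (Vec; []; _∷_; lookup)
open import Data.Vec.Properties using ([]=⇒lookup)
open import Data.Bool using (Bool; true; false; if_then_else_)
open import Data.List using ([]; _∷_; map; upTo; _++_)
open import Data.List.Properties using (map-++; upTo-∷ʳ)
open import Data.Maybe using (Maybe; just; nothing; maybe′)
open import Data.Maybe.Properties using (just-injective)
open import Data.Product using (∃; _,_)
open import Data.Sum using (_⊎_; inj₁; inj₂; swap)
import Data.Sum as Sum
import Data.Maybe as Maybe
open import Induction.WellFounded using (Acc; acc)
open import Relation.Nullary using (contradiction)
open import Function using (_∘′_)
open import Relation.Binary.PropositionalEquality

module Ancestry {V : Set} (parentOf : V → Maybe V) where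

  infix 4 _≼_
  _≼_ : V → V → Set
  a ≼ b = a ≡ b ⊎ Ancestor parentOf a b

  ancestor-trans : ∀ {a b c} → Ancestor parentOf a b → Ancestor parentOf b c → Ancestor parentOf a c
  ancestor-trans ab (parent e) = up e ab
  ancestor-trans ab (up e bc) = up e (ancestor-trans ab bc)

  ≼-ancestor-trans : ∀ {a b c} → a ≼ b → Ancestor parentOf b c → Ancestor parentOf a c
  ≼-ancestor-trans (inj₁ refl) bc = bc
  ≼-ancestor-trans (inj₂ ab) bc = ancestor-trans ab bc

  ancestor-≼-trans : ∀ {a b c} → Ancestor parentOf a b → b ≼ c → Ancestor parentOf a c
  ancestor-≼-trans ab (inj₁ refl) = ab
  ancestor-≼-trans ab (inj₂ bc) = ancestor-trans ab bc

  ≼-trans : ∀ {a b c} → a ≼ b → b ≼ c → a ≼ c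
  ≼-trans (inj₁ refl) bc = bc
  ≼-trans (inj₂ ab) bc = inj₂ (ancestor-≼-trans ab bc)

  ancestors-comparable : ∀ {a b z} → Ancestor parentOf a z → Ancestor parentOf b z → a ≼ b ⊎ b ≼ a
  ancestors-comparable (parent ea) (parent eb) = inj₁ (inj₁ (just-injective (trans (sym ea) eb)))
  ancestors-comparable (parent ea) (up eb by) with just-injective (trans (sym ea) eb)
  ... | refl = inj₂ (inj₂ by)
  ancestors-comparable (up ea ay) (parent eb) with just-injective (trans (sym ea) eb)
  ... | refl = inj₁ (inj₂ ay)
  ancestors-comparable (up ea ay) (up eb by) with just-injective (trans (sym ea) eb)
  ... | refl = ancestors-comparable ay by

  ≼-comparable : ∀ {a b z} → a ≼ z → b ≼ z → a ≼ b ⊎ b ≼ a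
  ≼-comparable (inj₁ refl) bz = inj₂ bz
  ≼-comparable az (inj₁ refl) = inj₁ az
  ≼-comparable (inj₂ az) (inj₂ bz) = ancestors-comparable az bz

  related-if-common-descendant : ∀ {a b z} → a ≼ z → b ≼ z → a ≢ b →
                                 Ancestor parentOf a b ⊎ Ancestor parentOf b a
  related-if-common-descendant az bz a≢b with ≼-comparable az bz
  ... | inj₁ (inj₁ a≡b) = contradiction a≡b a≢b
  ... | inj₁ (inj₂ ab) = inj₁ ab
  ... | inj₂ (inj₁ b≡a) = contradiction (sym b≡a) a≢b
  ... | inj₂ (inj₂ ba) = inj₂ ba

module _ {V : Set} {parentOf : V → Maybe V} (w h : V → ℕ)
         (descent : ∀ x → w x + maybe′ h 0 (parentOf x) ≤ h x) where

  private
    descent-at : ∀ {x p} → parentOf x ≡ p → w x + maybe′ h 0 p ≤ h x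
    descent-at {x} e = subst (λ p → w x + maybe′ h 0 p ≤ h x) e (descent x)

  chain-weight≤ : ∀ {x l} → Chain parentOf x l → sum (map w l) ≤ h x
  chain-weight≤ (root e) = descent-at e
  chain-weight≤ {x} (step e ch) = ≤-trans (+-monoʳ-≤ (w x) (chain-weight≤ ch)) (descent-at e)

  chain-exists : (∀ x → 0 < w x) → ∀ x → ∃ (Chain parentOf x)
  chain-exists w>0 x = go x (<-wellFounded (h x))
    where
    go : ∀ x → Acc _<_ (h x) → ∃ (Chain parentOf x)
    go x (acc rs) with parentOf x in e
    ... | nothing = _ , root e
    ... | just y with go y (rs (≤-trans (+-monoˡ-≤ (h y) (w>0 x)) (descent-at e)))
    ...   | l , ch = x ∷ l , step e ch

sum-map-upTo-suc : ∀ (f : ℕ → ℕ) j → sum (map f (upTo (suc j))) ≡ sum (map f (upTo j)) + f j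
sum-map-upTo-suc f j = begin
  sum (map f (upTo (suc j)))          ≡⟨ cong (sum ∘′ map f) (upTo-∷ʳ j) ⟨
  sum (map f (upTo j ++ j ∷ []))      ≡⟨ cong sum (map-++ f (upTo j) (j ∷ [])) ⟩
  sum (map f (upTo j) ++ f j ∷ [])    ≡⟨ sum-++ (map f (upTo j)) (f j ∷ []) ⟩
  sum (map f (upTo j)) + (f j + 0)    ≡⟨ cong (sum (map f (upTo j)) +_) (+-identityʳ (f j)) ⟩
  sum (map f (upTo j)) + f j          ∎
  where open ≡-Reasoning

sum-map-upTo-mono : ∀ (f : ℕ → ℕ) {i j} → i ≤ j → sum (map f (upTo i)) ≤ sum (map f (upTo j))
sum-map-upTo-mono f {j = zero} z≤n = ≤-refl
sum-map-upTo-mono f {i} {suc j} i≤1+j with m≤n⇒m<n∨m≡n i≤1+j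
... | inj₂ refl = ≤-refl
... | inj₁ i<1+j = ≤-trans (sum-map-upTo-mono f (s≤s⁻¹ i<1+j))
                    (≤-trans (m≤m+n _ (f j)) (≤-reflexive (sym (sum-map-upTo-suc f j))))

⌊n/2⌋<m : ∀ {n m} → n < 2 * m → ⌊ n /2⌋ < m
⌊n/2⌋<m {n} n<2m = *-cancelˡ-< 2 _ _ (≤-<-trans 2⌊n/2⌋≤n n<2m)
  where
  2⌊n/2⌋≤n : 2 * ⌊ n /2⌋ ≤ n
  2⌊n/2⌋≤n = begin
    ⌊ n /2⌋ + (⌊ n /2⌋ + 0) ≡⟨ cong (⌊ n /2⌋ +_) (+-identityʳ _) ⟩
    ⌊ n /2⌋ + ⌊ n /2⌋       ≤⟨ +-monoʳ-≤ ⌊ n /2⌋ (⌊n/2⌋≤⌈n/2⌉ n) ⟩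
    ⌊ n /2⌋ + ⌈ n /2⌉       ≡⟨ ⌊n/2⌋+⌈n/2⌉≡n n ⟩
    n                       ∎
    where open ≤-Reasoning

⌊1+n+n/2⌋≡n : ∀ n → ⌊ suc (n + n) /2⌋ ≡ n
⌊1+n+n/2⌋≡n zero = refl
⌊1+n+n/2⌋≡n (suc n) = cong suc (trans (cong ⌊_/2⌋ (+-suc n n)) (⌊1+n+n/2⌋≡n n))

⌊child/2⌋≡parent : ∀ {c p} → c ≡ 2 * p ⊎ c ≡ suc (2 * p) → ⌊ c /2⌋ ≡ p
⌊child/2⌋≡parent {p = p} (inj₁ refl) rewrite +-identityʳ p = sym (n≡⌊n+n/2⌋ p)
⌊child/2⌋≡parent {p = p} (inj₂ refl) rewrite +-identityʳ p = ⌊1+n+n/2⌋≡n p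

halve : ∀ {d e} → e ≡ suc d → Fin (2 ^ e) → Fin (2 ^ d)
halve refl p = fromℕ< (⌊n/2⌋<m (toℕ<n p))

toℕ-halve : ∀ {d e} (e≡1+d : e ≡ suc d) p → toℕ (halve e≡1+d p) ≡ ⌊ toℕ p /2⌋
toℕ-halve refl p = toℕ-fromℕ< _

previous : ∀ {N} → Fin N → Maybe (Fin N)
previous fz = nothing
previous (fs i) = just (inject₁ i)

previous-nothing : ∀ {N} (i : Fin N) → previous i ≡ nothing → toℕ i ≡ 0
previous-nothing fz _ = refl

previous-just : ∀ {N} (i : Fin N) {j} → previous i ≡ just j → toℕ i ≡ suc (toℕ j)
previous-just (fs i) refl = cong suc (sym (toℕ-inject₁ i))

if-cong : ∀ {A : Set} {b b′ : Bool} {x y : A} → b ≡ b′ → (if b then x else y) ≡ (if b′ then x else y)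
if-cong refl = refl

blockWeight : Bool → ℕ
blockWeight true = 4
blockWeight false = 3

offset : ∀ {N} → Vec Bool N → ℕ → ℕ
offset _ zero = 0
offset [] (suc j) = 0
offset (b ∷ bs) (suc j) = blockWeight b + offset bs j

offset-suc : ∀ {N} (bs : Vec Bool N) (i : Fin N) →
             offset bs (suc (toℕ i)) ≡ offset bs (toℕ i) + blockWeight (lookup bs i)
offset-suc (b ∷ bs) fz = +-comm (blockWeight b) 0
offset-suc (b ∷ bs) (fs i) = trans (cong (blockWeight b +_) (offset-suc bs i)) (sym (+-assoc (blockWeight b) _ _))

offset-mono : ∀ {N} (bs : Vec Bool N) {i j} → i ≤ j → offset bs i ≤ offset bs j
offset-mono bs z≤n = z≤n
offset-mono [] (s≤s i≤j) = ≤-refl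
offset-mono (b ∷ bs) (s≤s i≤j) = +-monoʳ-≤ (blockWeight b) (offset-mono bs i≤j)

offset-total : ∀ {N} (bs : Vec Bool N) → offset bs N ≡ 3 * N + ∣ bs ∣
offset-total [] = refl
offset-total {suc N} (true ∷ bs) = trans (cong (4 +_) (offset-total bs)) (regroup N ∣ bs ∣)
  where
  regroup : ∀ a b → 4 + (3 * a + b) ≡ 3 * suc a + suc b
  regroup = solve-∀
offset-total {suc N} (false ∷ bs) = trans (cong (3 +_) (offset-total bs)) (regroup N ∣ bs ∣)
  where
  regroup : ∀ a b → 3 + (3 * a + b) ≡ 3 * suc a + b
  regroup = solve-∀

module Construction (m k : ℕ) (C : Subset (2 ^ m)) where

  n : ℕ
  n = 2 ^ m

  instance
    n≢0 : NonZero n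
    n≢0 = m^n≢0 2 m

  covered : Fin n → Bool
  covered v = lookup C v

  blockStart : Fin n → ℕ
  blockStart v = offset C (toℕ v)

  spineWeight : ℕ
  spineWeight = offset C n

  treePathWeight : ℕ → ℕ
  treePathWeight j = sum (map (λ i → β m k + 3 * i) (upTo (suc j)))

  lastBlock : Fin n
  lastBlock = fromℕ< {n = n} (≤-reflexive (suc-pred n))

  1+lastBlock≡n : suc (toℕ lastBlock) ≡ n
  1+lastBlock≡n = trans (cong suc (toℕ-fromℕ< _)) (suc-pred n)

  ≤-lastBlock : ∀ (v : Fin n) → toℕ v ≤ toℕ lastBlock
  ≤-lastBlock v = subst (toℕ v ≤_) (sym (toℕ-fromℕ< _)) (toℕ≤pred[n] v)

  leaf : Fin 3 → Fin n → V' m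
  leaf i v = t i (fromℕ m) (fromℕ< (subst (λ d → toℕ v < 2 ^ d) (sym (toℕ-fromℕ m)) (toℕ<n v)))

  leaf≡ : ∀ i {v d p} → IsLeaf v d p → leaf i v ≡ t i d p
  leaf≡ i {d = d} (d≡m , p≡v) with toℕ-injective (trans (toℕ-fromℕ m) (sym d≡m))
  ... | refl = cong (t i d) (toℕ-injective (trans (toℕ-fromℕ< _) (sym p≡v)))

  firstV lastV : Fin n → V' m
  firstV v = if covered v then v₁ v else g₁ v
  lastV v = if covered v then v₂ v else g₃ v

  bottom : V' m
  bottom = lastV lastBlock

  previousLast : Fin n → Maybe (V' m)
  previousLast v = Maybe.map lastV (previous v)

  parentOf : V' m → Maybe (V' m)
  parentOf (v₁ v) = if covered v then previousLast v  else just (leaf t1 v)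
  parentOf (v₂ v) = if covered v then just (v₁ v)     else just (leaf t2 v)
  parentOf (g₁ v) = if covered v then just (leaf t1 v) else previousLast v
  parentOf (g₂ v) = if covered v then just (leaf t2 v) else just (g₁ v)
  parentOf (g₃ v) = if covered v then just (leaf t3 v) else just (g₂ v)
  parentOf (t i fz p) = just bottom
  parentOf (t i (fs d) p) = just (t i (inject₁ d) (halve (cong suc (sym (toℕ-inject₁ d))) p))

  weight : V' m → ℕ
  weight = w' k

  height : V' m → ℕ
  height (v₁ v) = if covered v then blockStart v + 2 else spineWeight + α m k + 2
  height (v₂ v) = if covered v then blockStart v + 4 else spineWeight + α m k + 2
  height (g₁ v) = if covered v then spineWeight + α m k + 1 else blockStart v + 1
  height (g₂ v) = if covered v then spineWeight + α m k + 1 else blockStart v + 2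
  height (g₃ v) = if covered v then spineWeight + α m k + 1 else blockStart v + 3
  height (t i d p) = spineWeight + treePathWeight (toℕ d)

  weight>0 : ∀ x → 0 < weight x
  weight>0 (v₁ _) = s≤s z≤n
  weight>0 (v₂ _) = s≤s z≤n
  weight>0 (g₁ _) = s≤s z≤n
  weight>0 (g₂ _) = s≤s z≤n
  weight>0 (g₃ _) = s≤s z≤n
  weight>0 (t _ d _) = ≤-trans (s≤s z≤n) (≤-trans (m≤n+m 3 (3 * n + k)) (m≤m+n (β m k) (3 * toℕ d)))

  height-lastV : ∀ v → height (lastV v) ≡ blockStart v + blockWeight (covered v)
  height-lastV v with covered v in e
  ... | true rewrite e = refl
  ... | false rewrite e = refl

  height-previousLast : ∀ v → maybe′ height 0 (previousLast v) ≡ blockStart v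
  height-previousLast v = go (previous v) refl
    where
    open ≡-Reasoning
    go : ∀ p → previous v ≡ p → maybe′ height 0 (Maybe.map lastV p) ≡ blockStart v
    go nothing eq = cong (offset C) (sym (previous-nothing v eq))
    go (just u) eq = begin
      height (lastV u)                        ≡⟨ height-lastV u ⟩
      blockStart u + blockWeight (covered u)  ≡⟨ offset-suc C u ⟨
      offset C (suc (toℕ u))                  ≡⟨ cong (offset C) (previous-just v eq) ⟨
      blockStart v                            ∎

  height-bottom : height bottom ≡ spineWeight
  height-bottom = begin
    height (lastV lastBlock)                                ≡⟨ height-lastV lastBlock ⟩
    blockStart lastBlock + blockWeight (covered lastBlock)  ≡⟨ offset-suc C lastBlock ⟨
    offset C (suc (toℕ lastBlock))                          ≡⟨ cong (offset C) 1+lastBlock≡n ⟩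
    spineWeight                                             ∎
    where open ≡-Reasoning

  height-leaf : ∀ i v → height (leaf i v) ≡ spineWeight + α m k
  height-leaf i v = cong (λ d → spineWeight + treePathWeight d) (toℕ-fromℕ m)

  hanging-descent : ∀ a i v → a + height (leaf i v) ≡ spineWeight + α m k + a
  hanging-descent a i v = trans (cong (a +_) (height-leaf i v)) (+-comm a _)

  descent : ∀ x → weight x + maybe′ height 0 (parentOf x) ≡ height x
  descent (v₁ v) with covered v in e
  ... | true = trans (cong (2 +_) (height-previousLast v)) (+-comm 2 (blockStart v))
  ... | false = hanging-descent 2 t1 v
  descent (v₂ v) with covered v in e
  ... | true rewrite e = trans (+-comm 2 (blockStart v + 2)) (+-assoc (blockStart v) 2 2)
  ... | false = hanging-descent 2 t2 v
  descent (g₁ v) with covered v in e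
  ... | true = hanging-descent 1 t1 v
  ... | false = trans (cong (1 +_) (height-previousLast v)) (+-comm 1 (blockStart v))
  descent (g₂ v) with covered v in e
  ... | true = hanging-descent 1 t2 v
  ... | false rewrite e = trans (+-comm 1 (blockStart v + 1)) (+-assoc (blockStart v) 1 1)
  descent (g₃ v) with covered v in e
  ... | true = hanging-descent 1 t3 v
  ... | false rewrite e = trans (+-comm 1 (blockStart v + 2)) (+-assoc (blockStart v) 2 1)
  descent (t i fz p) = begin
    (β m k + 0) + height bottom          ≡⟨ cong ((β m k + 0) +_) height-bottom ⟩
    (β m k + 0) + spineWeight            ≡⟨ +-comm _ spineWeight ⟩
    spineWeight + (β m k + 0)            ≡⟨ cong (spineWeight +_) (+-identityʳ _) ⟨
    spineWeight + treePathWeight 0       ∎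
    where open ≡-Reasoning
  descent (t i (fs d) p) = begin
    w + (spineWeight + treePathWeight (toℕ (inject₁ d)))
      ≡⟨ cong (λ j → w + (spineWeight + treePathWeight j)) (toℕ-inject₁ d) ⟩
    w + (spineWeight + treePathWeight (toℕ d))
      ≡⟨ rotate w spineWeight _ ⟩
    spineWeight + (treePathWeight (toℕ d) + w)
      ≡⟨ cong (spineWeight +_) (sum-map-upTo-suc (λ i → β m k + 3 * i) (suc (toℕ d))) ⟨
    spineWeight + treePathWeight (suc (toℕ d))
      ∎
    where
    open ≡-Reasoning
    w = weight (t i (fs d) p)
    rotate : ∀ a b c → a + (b + c) ≡ b + (c + a)
    rotate = solve-∀

  data InBlock : V' m → Fin n → Set where
    v₁∈ : ∀ {v} → covered v ≡ true  → InBlock (v₁ v) v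
    v₂∈ : ∀ {v} → covered v ≡ true  → InBlock (v₂ v) v
    g₁∈ : ∀ {v} → covered v ≡ false → InBlock (g₁ v) v
    g₂∈ : ∀ {v} → covered v ≡ false → InBlock (g₂ v) v
    g₃∈ : ∀ {v} → covered v ≡ false → InBlock (g₃ v) v

  OnSpine : V' m → Set
  OnSpine x = ∃ (InBlock x)

  data OffSpine : V' m → Set where
    tree-node : ∀ {i d p} → OffSpine (t i d p)
    v₁∉ : ∀ {v} → covered v ≡ false → OffSpine (v₁ v)
    v₂∉ : ∀ {v} → covered v ≡ false → OffSpine (v₂ v)
    g₁∉ : ∀ {v} → covered v ≡ true  → OffSpine (g₁ v)
    g₂∉ : ∀ {v} → covered v ≡ true  → OffSpine (g₂ v)
    g₃∉ : ∀ {v} → covered v ≡ true  → OffSpine (g₃ v)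

  on-or-off-spine : ∀ x → OnSpine x ⊎ OffSpine x
  on-or-off-spine (v₁ v) with covered v in e
  ... | true = inj₁ (v , v₁∈ e)
  ... | false = inj₂ (v₁∉ e)
  on-or-off-spine (v₂ v) with covered v in e
  ... | true = inj₁ (v , v₂∈ e)
  ... | false = inj₂ (v₂∉ e)
  on-or-off-spine (g₁ v) with covered v in e
  ... | true = inj₂ (g₁∉ e)
  ... | false = inj₁ (v , g₁∈ e)
  on-or-off-spine (g₂ v) with covered v in e
  ... | true = inj₂ (g₂∉ e)
  ... | false = inj₁ (v , g₂∈ e)
  on-or-off-spine (g₃ v) with covered v in e
  ... | true = inj₂ (g₃∉ e)
  ... | false = inj₁ (v , g₃∈ e)
  on-or-off-spine (t i d p) = inj₂ tree-node

  depthBound : ℕ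
  depthBound = spineWeight + α m k + 2

  height-inBlock : ∀ {x v} → InBlock x v → height x ≤ blockStart v + blockWeight (covered v)
  height-inBlock {v = v} (v₁∈ e) rewrite e = +-monoʳ-≤ (blockStart v) (s≤s (s≤s z≤n))
  height-inBlock {v = v} (v₂∈ e) rewrite e = ≤-refl
  height-inBlock {v = v} (g₁∈ e) rewrite e = +-monoʳ-≤ (blockStart v) (s≤s z≤n)
  height-inBlock {v = v} (g₂∈ e) rewrite e = +-monoʳ-≤ (blockStart v) (s≤s (s≤s z≤n))
  height-inBlock {v = v} (g₃∈ e) rewrite e = ≤-refl

  height-offSpine : ∀ {x} → OffSpine x → height x ≤ depthBound
  height-offSpine (tree-node {d = d}) =
    ≤-trans (+-monoʳ-≤ spineWeight (sum-map-upTo-mono _ (s≤s (toℕ≤pred[n] d)))) (m≤m+n _ 2)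
  height-offSpine (v₁∉ e) rewrite e = ≤-refl
  height-offSpine (v₂∉ e) rewrite e = ≤-refl
  height-offSpine (g₁∉ e) rewrite e = +-monoʳ-≤ (spineWeight + α m k) (s≤s z≤n)
  height-offSpine (g₂∉ e) rewrite e = +-monoʳ-≤ (spineWeight + α m k) (s≤s z≤n)
  height-offSpine (g₃∉ e) rewrite e = +-monoʳ-≤ (spineWeight + α m k) (s≤s z≤n)

  height≤ : ∀ x → height x ≤ depthBound
  height≤ x with on-or-off-spine x
  ... | inj₂ off = height-offSpine off
  ... | inj₁ (v , x∈v) = begin
    height x                                ≤⟨ height-inBlock x∈v ⟩
    blockStart v + blockWeight (covered v)  ≡⟨ offset-suc C v ⟨
    offset C (suc (toℕ v))                  ≤⟨ offset-mono C (toℕ<n v) ⟩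
    spineWeight                             ≤⟨ m≤m+n spineWeight (α m k) ⟩
    spineWeight + α m k                     ≤⟨ m≤m+n _ 2 ⟩
    depthBound                              ∎
    where open ≤-Reasoning

  open Ancestry parentOf

  inBlock≼lastV : ∀ {x v} → InBlock x v → x ≼ lastV v
  inBlock≼lastV (v₁∈ e) rewrite e = inj₂ (parent (if-cong e))
  inBlock≼lastV (v₂∈ e) rewrite e = inj₁ refl
  inBlock≼lastV (g₁∈ e) rewrite e = inj₂ (up (if-cong e) (parent (if-cong e)))
  inBlock≼lastV (g₂∈ e) rewrite e = inj₂ (parent (if-cong e))
  inBlock≼lastV (g₃∈ e) rewrite e = inj₁ refl

  firstV∈ : ∀ v → InBlock (firstV v) v
  firstV∈ v with covered v in e
  ... | true = v₁∈ e
  ... | false = g₁∈ e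

  parent-firstV : ∀ v → parentOf (firstV v) ≡ previousLast v
  parent-firstV v with covered v in e
  ... | true = if-cong e
  ... | false = if-cong e

  lastV≼lastV : ∀ j {u v} → toℕ v ≡ j → toℕ u ≤ j → lastV u ≼ lastV v
  lastV≼lastV zero v≡0 u≤0 = inj₁ (cong lastV (toℕ-injective (trans (n≤0⇒n≡0 u≤0) (sym v≡0))))
  lastV≼lastV (suc j) {u} {v} v≡1+j u≤1+j with m≤n⇒m<n∨m≡n u≤1+j | previous v in eq
  ... | inj₂ u≡1+j | _ = inj₁ (cong lastV (toℕ-injective (trans u≡1+j (sym v≡1+j))))
  ... | inj₁ _ | nothing = contradiction (trans (sym v≡1+j) (previous-nothing v eq)) λ ()
  ... | inj₁ u<1+j | just w =
    ≼-trans (lastV≼lastV j (suc-injective (trans (sym (previous-just v eq)) v≡1+j)) (s≤s⁻¹ u<1+j))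
            (inj₂ (ancestor-≼-trans (parent (trans (parent-firstV v) (cong (Maybe.map lastV) eq)))
                                   (inBlock≼lastV (firstV∈ v))))

  spine≼bottom : ∀ {x} → OnSpine x → x ≼ bottom
  spine≼bottom (v , x∈v) = ≼-trans (inBlock≼lastV x∈v) (lastV≼lastV _ refl (≤-lastBlock v))

  bottom-ancestor-tree : ∀ i d p → Ancestor parentOf bottom (t i d p)
  bottom-ancestor-tree i = <-weakInduction (λ d → ∀ p → Ancestor parentOf bottom (t i d p))
                             (λ _ → parent refl) (λ _ below _ → up refl (below _))

  bottom-ancestor : ∀ {x} → OffSpine x → Ancestor parentOf bottom x
  bottom-ancestor tree-node = bottom-ancestor-tree _ _ _
  bottom-ancestor (v₁∉ e) = up (if-cong e) (bottom-ancestor-tree _ _ _)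
  bottom-ancestor (v₂∉ e) = up (if-cong e) (bottom-ancestor-tree _ _ _)
  bottom-ancestor (g₁∉ e) = up (if-cong e) (bottom-ancestor-tree _ _ _)
  bottom-ancestor (g₂∉ e) = up (if-cong e) (bottom-ancestor-tree _ _ _)
  bottom-ancestor (g₃∉ e) = up (if-cong e) (bottom-ancestor-tree _ _ _)

  Related : V' m → V' m → Set
  Related x y = Ancestor parentOf x y ⊎ Ancestor parentOf y x

  spine-related : ∀ {x y} → OnSpine x → x ≢ y → Related x y
  spine-related {y = y} x∈ x≢y with on-or-off-spine y
  ... | inj₁ y∈ = related-if-common-descendant (spine≼bottom x∈) (spine≼bottom y∈) x≢y
  ... | inj₂ y∉ = inj₁ (≼-ancestor-trans (spine≼bottom x∈) (bottom-ancestor y∉))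

  t-cong : ∀ i {d d′ : Fin (suc m)} {p : Fin (2 ^ toℕ d)} {p′ : Fin (2 ^ toℕ d′)} →
           toℕ d ≡ toℕ d′ → toℕ p ≡ toℕ p′ → t i d p ≡ t i d′ p′
  t-cong i d≡d′ p≡p′ with toℕ-injective d≡d′
  ... | refl = cong (t i _) (toℕ-injective p≡p′)

  parent-tree-child : ∀ {i} {d d′ : Fin (suc m)} {p : Fin (2 ^ toℕ d)} {p′ : Fin (2 ^ toℕ d′)} →
                      toℕ d′ ≡ suc (toℕ d) → (toℕ p′ ≡ 2 * toℕ p ⊎ toℕ p′ ≡ suc (2 * toℕ p)) →
                      parentOf (t i d′ p′) ≡ just (t i d p)
  parent-tree-child {d′ = fs d′} {p′ = p′} d′≡1+d child =
    cong just (t-cong _ (trans (toℕ-inject₁ d′) (suc-injective d′≡1+d))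
                        (trans (toℕ-halve (cong suc (sym (toℕ-inject₁ d′))) p′) (⌊child/2⌋≡parent child)))

  module _ (G : SimpleGraph n) (cover : IsVertexCover G C) where

    covered-endpoint : ∀ {u v} → adj G u v ≡ true → covered u ≡ true ⊎ covered v ≡ true
    covered-endpoint a = Sum.map []=⇒lookup []=⇒lookup (cover _ _ a)

    adjacent-distinct : ∀ {u v} → adj G u v ≡ true → u ≢ v
    adjacent-distinct {u} a refl with trans (sym a) (irrefl G u)
    ... | ()

    vertex-edge : ∀ {u v} (x : Fin n → V' m) (y : Fin n → V' m) →
                  (∀ {w} → covered w ≡ true → InBlock (x w) w) → (∀ {w} → covered w ≡ true → InBlock (y w) w) →
                  x u ≢ y v → adj G u v ≡ true → Related (x u) (y v)
    vertex-edge x y x∈ y∈ x≢y a with covered-endpoint a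
    ... | inj₁ e = spine-related (_ , x∈ e) x≢y
    ... | inj₂ e = swap (spine-related (_ , y∈ e) (x≢y ∘′ sym))

    gadget-edge : ∀ {v} (x : Fin n → V' m) (y : Fin n → V' m) →
                  (∀ {w} → covered w ≡ false → InBlock (x w) w) → (∀ {w} → covered w ≡ true → InBlock (y w) w) →
                  x v ≢ y v → Related (x v) (y v)
    gadget-edge {v} x y x∈ y∈ x≢y with covered v in e
    ... | true = swap (spine-related (_ , y∈ e) (x≢y ∘′ sym))
    ... | false = spine-related (_ , x∈ e) x≢y

    edge-related : ∀ {x y} → E₀ G x y → Related x y
    edge-related (e11 a) = vertex-edge v₁ v₁ v₁∈ v₁∈ (λ { refl → adjacent-distinct a refl }) a
    edge-related (e22 a) = vertex-edge v₂ v₂ v₂∈ v₂∈ (λ { refl → adjacent-distinct a refl }) a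
    edge-related (e12 a) = vertex-edge v₁ v₂ v₁∈ v₂∈ (λ ()) a
    edge-related (e21 a) = vertex-edge v₂ v₁ v₂∈ v₁∈ (λ ()) a
    edge-related g1-1 = gadget-edge g₁ v₁ g₁∈ v₁∈ (λ ())
    edge-related g1-2 = gadget-edge g₁ v₂ g₁∈ v₂∈ (λ ())
    edge-related g2-1 = gadget-edge g₂ v₁ g₂∈ v₁∈ (λ ())
    edge-related g2-2 = gadget-edge g₂ v₂ g₂∈ v₂∈ (λ ())
    edge-related g3-1 = gadget-edge g₃ v₁ g₃∈ v₁∈ (λ ())
    edge-related g3-2 = gadget-edge g₃ v₂ g₃∈ v₂∈ (λ ())
    edge-related (tree d′≡1+d child) = inj₁ (parent (parent-tree-child d′≡1+d child))
    edge-related (l-v1 {v} leaf-v) with covered v in e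
    ... | true = spine-related (_ , v₁∈ e) (λ ())
    ... | false = inj₂ (parent (trans (if-cong e) (cong just (leaf≡ t1 leaf-v))))
    edge-related (l-v2 {v} leaf-v) with covered v in e
    ... | true = spine-related (_ , v₂∈ e) (λ ())
    ... | false = inj₂ (parent (trans (if-cong e) (cong just (leaf≡ t2 leaf-v))))
    edge-related (l-g1 {v} leaf-v) with covered v in e
    ... | true = inj₂ (parent (trans (if-cong e) (cong just (leaf≡ t1 leaf-v))))
    ... | false = spine-related (_ , g₁∈ e) (λ ())
    edge-related (l-g2 {v} leaf-v) with covered v in e
    ... | true = inj₂ (parent (trans (if-cong e) (cong just (leaf≡ t2 leaf-v))))
    ... | false = spine-related (_ , g₂∈ e) (λ ())
    edge-related (l-g3 {v} leaf-v) with covered v in e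
    ... | true = inj₂ (parent (trans (if-cong e) (cong just (leaf≡ t3 leaf-v))))
    ... | false = spine-related (_ , g₃∈ e) (λ ())

-- The degree bound and the range of k are needed only for the converse direction of the reduction.
lemma1 : (m : ℕ) (G : SimpleGraph (2 ^ m)) → MaxDegreeAtMost G 3 →
         (k : ℕ) → 1 < k → k < 2 ^ m ∸ 1 →
         HasVertexCoverOfSize G k →
         HasTDOfWeightedDepth (V' m) (E' G) (w' k) (k' m k)
lemma1 m G _ k _ _ (C , cover , ∣C∣≡k) = decomposition , depth≤k′
  where
  open Construction m k C

  descent≤ : ∀ x → weight x + maybe′ height 0 (parentOf x) ≤ height x
  descent≤ x = ≤-reflexive (descent x)

  decomposition : TreedepthDecomposition (V' m) (E' G)
  decomposition = record
    { par     = parentOf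
    ; rooted  = chain-exists weight height descent≤ weight>0
    ; edgesOK = λ { _ _ (inj₁ xy) → edge-related G cover xy
                  ; _ _ (inj₂ yx) → swap (edge-related G cover yx) } }

  depthBound≡k′ : depthBound ≡ k' m k
  depthBound≡k′ = cong (λ s → s + α m k + 2) (trans (offset-total C) (cong (3 * 2 ^ m +_) ∣C∣≡k))

  depth≤k′ : WeightedDepthAtMost (w' k) decomposition (k' m k)
  depth≤k′ x _ chain = ≤-trans (chain-weight≤ weight height descent≤ chain)
                                (≤-trans (height≤ x) (≤-reflexive depthBound≡k′))
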